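{- For any two graphs $G$ and $H$, $$\max\{\mathrm{mob}(G),\mathrm{mob}(H\vee K_1)\}\le \mathrm{mob}(G\odot H)\le \max\{n(G),\mathrm{gp}(H\vee K_1)\},$$ where $n(G)=|V(G)|$.
   Context: For graphs $G$ with $V(G)=\{v_1,\dots,v_n\}$ and $H$, the corona product $G\odot H$ is obtained from one copy of $G$ and $n$ disjoint copies $H^1,\dots,H^n$ of $H$ by joining $v_i$ to every vertex of $H^i$, for each $i$. The join $G\vee H$ is the disjoint union of $G$ and $H$ with all edges between $V(G)$ and $V(H)$ added. A set $S\subseteq V(G)$ is a general position set if no three vertices of $S$ lie on a common shortest path; $\mathrm{gp}(G)$ is the maximum size of such a set. Robots are placed one per vertex of a general position set $S$; a move $u\to v$ along an edge $uv$ with $u\in S$ is legal if $v\notin S$ and $(S\setminus\{u\})\cup\{v\}$ is a general position set. $S$ is a mobile general position set if some sequence of legal moves starting from $S$ visits every vertex at least once; $\mathrm{mob}(G)$ is the maximum size of a mobile general position set. -}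

module Defs where

open import Data.Nat using (ℕ; zero; suc; _+_; _*_; _≤_)
open import Data.Bool using (Bool; true; false; _∧_; T)
open import Data.Fin using (Fin; splitAt; remQuot; _≟_)
open import Data.Fin.Subset using (Subset; _∈_; _∉_; ∣_∣; inside; outside)
open import Data.Vec using (_[_]≔_)
open import Data.List using (List; []; _∷_; length)
open import Data.List.Relation.Unary.Any using (Any)
import Data.List.Membership.Propositional as LM
open import Data.Sum using (_⊎_; inj₁; inj₂)
open import Data.Product using (Σ; ∃; _×_; _,_)
open import Data.Unit using (⊤)
open import Relation.Nullary using (¬_; ⌊_⌋)
open import Relation.Binary.PropositionalEquality using (_≡_; _≢_)

Graph : ℕ → Set
Graph n = Fin n → Fin n → Bool

Simple : ∀ {n} → Graph n → Set
Simple {n} G = (∀ (i j : Fin n) → G i j ≡ G j i) × (∀ (i : Fin n) → G i i ≡ false)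

data Walk {n : ℕ} (G : Graph n) : Fin n → Fin n → Set where
  stop : ∀ {x} → Walk G x x
  step : ∀ {x y z} → T (G x y) → Walk G y z → Walk G x z

len : ∀ {n} {G : Graph n} {x y} → Walk G x y → ℕ
len stop = 0
len (step _ w) = suc (len w)

verts : ∀ {n} {G : Graph n} {x y} → Walk G x y → List (Fin n)
verts {x = x} stop = x ∷ []
verts {x = x} (step _ w) = x ∷ verts w

Connected : ∀ {n} → Graph n → Set
Connected {n} G = ∀ (x y : Fin n) → Walk G x y

Shortest : ∀ {n} {G : Graph n} {x y} → Walk G x y → Set
Shortest {G = G} {x} {y} P = ∀ (Q : Walk G x y) → len P ≤ len Q

OnCommonShortestPath : ∀ {n} → Graph n → Fin n → Fin n → Fin n → Set
OnCommonShortestPath {n} G u v w =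
  Σ (Fin n) λ x → Σ (Fin n) λ y → Σ (Walk G x y) λ P →
    Shortest P × (u LM.∈ verts P) × (v LM.∈ verts P) × (w LM.∈ verts P)

GenPos : ∀ {n} → Graph n → Subset n → Set
GenPos {n} G S = ∀ (u v w : Fin n) → u ∈ S → v ∈ S → w ∈ S →
  u ≢ v → v ≢ w → u ≢ w → ¬ OnCommonShortestPath G u v w

IsMaxSize : ∀ {n} → (Subset n → Set) → ℕ → Set
IsMaxSize {n} P k = (Σ (Subset n) λ S → P S × ∣ S ∣ ≡ k) × (∀ (S : Subset n) → P S → ∣ S ∣ ≤ k)

IsGp : ∀ {n} → Graph n → ℕ → Set
IsGp G k = IsMaxSize (GenPos G) k

LegalMove : ∀ {n} → Graph n → Subset n → Subset n → Set
LegalMove {n} G S S' = Σ (Fin n) λ u → Σ (Fin n) λ v →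
  u ∈ S × v ∉ S × T (G u v) × (S' ≡ ((S [ u ]≔ outside) [ v ]≔ inside)) × GenPos G S'

Chain : ∀ {n} → Graph n → Subset n → List (Subset n) → Set
Chain G S [] = ⊤
Chain G S (S' ∷ cs) = LegalMove G S S' × Chain G S' cs

Mobile : ∀ {n} → Graph n → Subset n → Set
Mobile {n} G S = GenPos G S × Σ (List (Subset n)) λ cs →
  Chain G S cs × (∀ (x : Fin n) → Any (λ C → x ∈ C) (S ∷ cs))

IsMob : ∀ {n} → Graph n → ℕ → Set
IsMob G k = IsMaxSize (Mobile G) k

join : ∀ {n m} → Graph n → Graph m → Graph (n + m)
join {n} {m} G H a b with splitAt n a | splitAt n b
... | inj₁ i | inj₁ j = G i j
... | inj₂ i | inj₂ j = H i j
... | inj₁ _ | inj₂ _ = true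
... | inj₂ _ | inj₁ _ = true

K₁ : Graph 1
K₁ _ _ = false

-- corona G ⊙ H on Fin (n + n * m): first n vertices are G,
-- vertex (i , a) (encoded via remQuot) is vertex a of the copy H^i
corona : ∀ {n m} → Graph n → Graph m → Graph (n + n * m)
corona {n} {m} G H a b with splitAt n a | splitAt n b
... | inj₁ i | inj₁ j = G i j
... | inj₁ i | inj₂ q with remQuot {n} m q
...   | (j , _) = ⌊ i ≟ j ⌋
corona {n} {m} G H a b | inj₂ p | inj₁ j with remQuot {n} m p
...   | (i , _) = ⌊ i ≟ j ⌋
corona {n} {m} G H a b | inj₂ p | inj₂ q with remQuot {n} m p | remQuot {n} m q
...   | (i , x) | (j , y) = ⌊ i ≟ j ⌋ ∧ H x y

-- Both lower bounds embed a graph into G ⊙ H so that general position, legal moves and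
-- the number of robots are preserved: G sits on the base vertices ι j, and H ∨ K₁ on a
-- closed copy {ι i} ∪ H^i with its apex at ι i.  It remains to let the robots also visit
-- the vertices outside the image.  For G, whenever ι j is occupied its robot steps
-- ι j → h j x → ι j; no other robot is in H^j and ι j separates H^j from the rest, so
-- general position survives.  For H ∨ K₁, whenever the apex ι i is occupied its robot tours
-- the rest of G ⊙ H along walks through base vertices; the robots left in H^i are pairwise
-- adjacent (otherwise the apex would lie between two of them), and a shortest path from
-- outside H^i meets H^i in a single vertex, so no three robots lie on a shortest path.
--
-- For the upper bound, suppose some configuration of the run contains a base vertex ι j
-- and a vertex of H^j.  Then ι j lies on a shortest path from that vertex to anything
-- outside {ι j} ∪ H^j, so the configuration lies in this closed copy, an isometric copy of
-- H ∨ K₁, and has at most gp(H ∨ K₁) robots; moves keep the number of robots.  Otherwise,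
-- two robots in a common H^j could never both leave it, so ι j would never be visited;
-- hence the initial configuration meets every closed copy at most once and has at most n
-- robots.

module Submission where

open import Defs
open import Data.Nat using (ℕ; zero; suc; _+_; _*_; _≤_; _⊔_; z≤n; s≤s)
open import Data.Nat.Properties
  using (≤-refl; ≤-reflexive; ≤-trans; ≤-pred; _≤?_; ≰⇒>; <⇒≱; n≤1+n; n<1+n; m<m+n; m≤m⊔n; m≤n⊔m; ⊔-lub;
         +-mono-≤; +-monoʳ-≤; +-monoˡ-≤; +-cancelʳ-≤; +-cancelˡ-≤; module ≤-Reasoning)
open import Data.Bool using (Bool; true; false; T; _∧_; if_then_else_)
open import Data.Fin using (Fin; zero; suc; _≟_; _↑ˡ_; _↑ʳ_; splitAt; remQuot; combine)
open import Data.Fin.Properties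
  using (0≢1+n; suc-injective; any?; splitAt-↑ˡ; splitAt-↑ʳ; splitAt⁻¹-↑ˡ; splitAt⁻¹-↑ʳ; combine-remQuot; remQuot-combine; combine-injective; ↑ˡ-injective; ↑ʳ-injective)
open import Data.Fin.Subset using (Subset; _∈_; _∉_; ∣_∣; inside; outside; ⊤)
open import Data.Fin.Subset.Properties using (⊆-antisym; _∈?_; ∈⊤; ∣⊤∣≡n)
open import Data.Vec using ([]; _∷_; here; there; lookup; tabulate; _[_]≔_)
open import Data.Vec.Properties
  using ([]=⇒lookup; lookup⇒[]=; []=-injective; lookup∘update′; lookup∘tabulate;
         []≔-minimal; []≔-updates; []≔-idempotent; []≔-lookup)
open import Data.List using (List; []; _∷_; _++_)
open import Data.List.Relation.Unary.Any using (Any; here; there) renaming (any? to anyᴸ?)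
open import Data.List.Relation.Unary.Any.Properties using (++⁺ˡ; ++⁺ʳ)
open import Data.List.Membership.Propositional using () renaming (_∈_ to _∈ᴸ_)
open import Data.Sum using (_⊎_; inj₁; inj₂; [_,_]′)
open import Data.Product using (Σ; _×_; _,_; proj₁; proj₂; uncurry)
open import Data.Empty using (⊥; ⊥-elim)
open import Data.Unit using (tt)
open import Function using (_∘_)
open import Relation.Nullary using (¬_; Dec; yes; no; ⌊_⌋)
open import Relation.Nullary.Decidable using (T?; _×-dec_; dec-true; isYes≗does; toWitness)
open import Relation.Binary.PropositionalEquality hiding (J)

⌊≟⌋-refl : ∀ {k} (i : Fin k) → ⌊ i ≟ i ⌋ ≡ true
⌊≟⌋-refl i = trans (isYes≗does (i ≟ i)) (dec-true (i ≟ i) refl)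

module _ {k : ℕ} {S : Subset k} where

  ∈-≔⁺ : ∀ {u p b} → p ≢ u → p ∈ S → p ∈ S [ u ]≔ b
  ∈-≔⁺ {u} {p} p≢u = []≔-minimal S p u p≢u

  ∈-≔⁻ : ∀ {u p b} → p ≢ u → p ∈ S [ u ]≔ b → p ∈ S
  ∈-≔⁻ {u} {p} {b} p≢u p∈ = lookup⇒[]= p S (trans (sym (lookup∘update′ p≢u S b)) ([]=⇒lookup p∈))

  ∉-≔outside : ∀ u → u ∉ S [ u ]≔ outside
  ∉-≔outside u u∈ with []=-injective u∈ ([]≔-updates S u)
  ... | ()

  ∉-≔outside⁺ : ∀ {u p} → p ∉ S → p ∉ S [ u ]≔ outside
  ∉-≔outside⁺ {u} {p} p∉S with p ≟ u
  ... | yes refl = ∉-≔outside u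
  ... | no p≢u   = p∉S ∘ ∈-≔⁻ p≢u

  ∉⇒lookup≡false : ∀ {p} → p ∉ S → lookup S p ≡ false
  ∉⇒lookup≡false {p} p∉S with lookup S p in eq
  ... | true  = ⊥-elim (p∉S (lookup⇒[]= p S eq))
  ... | false = refl

module _ {k : ℕ} {f : Fin k → Bool} {p : Fin k} where

  ∈-tabulate⁺ : f p ≡ true → p ∈ tabulate f
  ∈-tabulate⁺ fp = lookup⇒[]= p (tabulate f) (trans (lookup∘tabulate f p) fp)

  ∈-tabulate⁻ : p ∈ tabulate f → f p ≡ true
  ∈-tabulate⁻ p∈ = trans (sym (lookup∘tabulate f p)) ([]=⇒lookup p∈)

∣∣-≔outside : ∀ {k} (S : Subset k) {j} → j ∈ S → suc ∣ S [ j ]≔ outside ∣ ≡ ∣ S ∣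
∣∣-≔outside (true ∷ S) here = refl
∣∣-≔outside (true ∷ S) (there j∈S) = cong suc (∣∣-≔outside S j∈S)
∣∣-≔outside (false ∷ S) (there j∈S) = ∣∣-≔outside S j∈S

injection⇒∣∣≤ : ∀ {k l} (S : Subset k) (T : Subset l) (f : Fin k → Fin l) →
  (∀ {x} → x ∈ S → f x ∈ T) → (∀ {x y} → x ∈ S → y ∈ S → f x ≡ f y → x ≡ y) →
  ∣ S ∣ ≤ ∣ T ∣
injection⇒∣∣≤ [] T f into inj = z≤n
injection⇒∣∣≤ (false ∷ S) T f into inj =
  injection⇒∣∣≤ S T (f ∘ suc) (into ∘ there) (λ x∈ y∈ eq → suc-injective (inj (there x∈) (there y∈) eq))
injection⇒∣∣≤ (true ∷ S) T f into inj = begin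
  suc ∣ S ∣                      ≤⟨ s≤s (injection⇒∣∣≤ S (T [ f zero ]≔ outside) (f ∘ suc) into′ inj′) ⟩
  suc ∣ T [ f zero ]≔ outside ∣  ≡⟨ ∣∣-≔outside T (into here) ⟩
  ∣ T ∣                          ∎
  where
    open ≤-Reasoning
    into′ : ∀ {x} → x ∈ S → f (suc x) ∈ T [ f zero ]≔ outside
    into′ x∈ = ∈-≔⁺ (λ eq → 0≢1+n (sym (inj (there x∈) here eq))) (into (there x∈))
    inj′ : ∀ {x y} → x ∈ S → y ∈ S → f (suc x) ≡ f (suc y) → x ≡ y
    inj′ x∈ y∈ eq = suc-injective (inj (there x∈) (there y∈) eq)

shift : ∀ {k} → Subset k → Fin k → Fin k → Subset k
shift S u v = (S [ u ]≔ outside) [ v ]≔ inside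

module _ {k : ℕ} {S : Subset k} where

  target∈shift : ∀ {u v} → v ∈ shift S u v
  target∈shift {u} {v} = []≔-updates (S [ u ]≔ outside) v

  ∈-shift⁺ : ∀ {u v p} → p ≢ u → p ∈ S → p ∈ shift S u v
  ∈-shift⁺ {u} {v} {p} p≢u p∈S with p ≟ v
  ... | yes refl = target∈shift
  ... | no p≢v   = ∈-≔⁺ p≢v (∈-≔⁺ p≢u p∈S)

  ∈-shift⁻ : ∀ {u v p} → p ∈ shift S u v → p ≡ v ⊎ (p ≢ u × p ∈ S)
  ∈-shift⁻ {u} {v} {p} p∈ with p ≟ v | p ≟ u
  ... | yes p≡v | _        = inj₁ p≡v
  ... | no p≢v  | yes refl = ⊥-elim (∉-≔outside p (∈-≔⁻ p≢v p∈))
  ... | no p≢v  | no p≢u   = inj₂ (p≢u , ∈-≔⁻ p≢u (∈-≔⁻ p≢v p∈))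

  shift-refl : ∀ {u} → u ∈ S → shift S u u ≡ S
  shift-refl {u} u∈S = begin
    (S [ u ]≔ outside) [ u ]≔ inside  ≡⟨ []≔-idempotent S u ⟩
    S [ u ]≔ inside                   ≡⟨ cong (S [ u ]≔_) ([]=⇒lookup u∈S) ⟨
    S [ u ]≔ lookup S u               ≡⟨ []≔-lookup S u ⟩
    S                                 ∎
    where open ≡-Reasoning

  shift-shift : ∀ {u v w} → v ∉ S [ u ]≔ outside → shift (shift S u v) v w ≡ shift S u w
  shift-shift {u} {v} {w} v∉ = cong (_[ w ]≔ inside) (begin
    (R [ v ]≔ inside) [ v ]≔ outside  ≡⟨ []≔-idempotent R v ⟩
    R [ v ]≔ outside                  ≡⟨ cong (R [ v ]≔_) (∉⇒lookup≡false v∉) ⟨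
    R [ v ]≔ lookup R v               ≡⟨ []≔-lookup R v ⟩
    R                                 ∎)
    where
      open ≡-Reasoning
      R : Subset k
      R = S [ u ]≔ outside

module WalkProperties {k : ℕ} (Γ : Graph k) where

  infixr 5 _++ʷ_
  _++ʷ_ : ∀ {x y z} → Walk Γ x y → Walk Γ y z → Walk Γ x z
  stop     ++ʷ Q = Q
  step e P ++ʷ Q = step e (P ++ʷ Q)

  len-++ʷ : ∀ {x y z} (P : Walk Γ x y) (Q : Walk Γ y z) → len (P ++ʷ Q) ≡ len P + len Q
  len-++ʷ stop       Q = refl
  len-++ʷ (step e P) Q = cong suc (len-++ʷ P Q)

  ++ʷ-assoc : ∀ {x y z u} (P : Walk Γ x y) (Q : Walk Γ y z) (R : Walk Γ z u) →
    (P ++ʷ Q) ++ʷ R ≡ P ++ʷ (Q ++ʷ R)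
  ++ʷ-assoc stop       Q R = refl
  ++ʷ-assoc (step e P) Q R = cong (step e) (++ʷ-assoc P Q R)

  source∈verts : ∀ {x y} (P : Walk Γ x y) → x ∈ᴸ verts P
  source∈verts stop       = here refl
  source∈verts (step e P) = here refl

  target∈verts : ∀ {x y} (P : Walk Γ x y) → y ∈ᴸ verts P
  target∈verts stop       = here refl
  target∈verts (step e P) = there (target∈verts P)

  ∈-++ʷ⁺ˡ : ∀ {x y z v} (P : Walk Γ x y) (Q : Walk Γ y z) → v ∈ᴸ verts P → v ∈ᴸ verts (P ++ʷ Q)
  ∈-++ʷ⁺ˡ stop       Q (here refl) = source∈verts Q
  ∈-++ʷ⁺ˡ (step e P) Q (here refl) = here refl
  ∈-++ʷ⁺ˡ (step e P) Q (there v∈P) = there (∈-++ʷ⁺ˡ P Q v∈P)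

  ∈-++ʷ⁺ʳ : ∀ {x y z v} (P : Walk Γ x y) (Q : Walk Γ y z) → v ∈ᴸ verts Q → v ∈ᴸ verts (P ++ʷ Q)
  ∈-++ʷ⁺ʳ stop       Q v∈Q = v∈Q
  ∈-++ʷ⁺ʳ (step e P) Q v∈Q = there (∈-++ʷ⁺ʳ P Q v∈Q)

  ∈-++ʷ⁻ : ∀ {x y z v} (P : Walk Γ x y) (Q : Walk Γ y z) →
    v ∈ᴸ verts (P ++ʷ Q) → v ∈ᴸ verts P ⊎ v ∈ᴸ verts Q
  ∈-++ʷ⁻ stop       Q v∈ = inj₂ v∈
  ∈-++ʷ⁻ (step e P) Q (here refl) = inj₁ (here refl)
  ∈-++ʷ⁻ (step e P) Q (there v∈) with ∈-++ʷ⁻ P Q v∈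
  ... | inj₁ v∈P = inj₁ (there v∈P)
  ... | inj₂ v∈Q = inj₂ v∈Q

  splitAtVertex : ∀ {x y u} (P : Walk Γ x y) → u ∈ᴸ verts P →
    Σ (Walk Γ x u) λ P₁ → Σ (Walk Γ u y) λ P₂ → P ≡ P₁ ++ʷ P₂
  splitAtVertex stop       (here refl) = stop , stop , refl
  splitAtVertex (step e P) (here refl) = stop , step e P , refl
  splitAtVertex (step e P) (there u∈P) with splitAtVertex P u∈P
  ... | P₁ , P₂ , refl = step e P₁ , P₂ , refl

  Shortest-prefix : ∀ {x y z} (P : Walk Γ x y) (Q : Walk Γ y z) → Shortest (P ++ʷ Q) → Shortest P
  Shortest-prefix P Q sh R = +-cancelʳ-≤ (len Q) (len P) (len R)
    (subst₂ _≤_ (len-++ʷ P Q) (len-++ʷ R Q) (sh (R ++ʷ Q)))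

  Shortest-suffix : ∀ {x y z} (P : Walk Γ x y) (Q : Walk Γ y z) → Shortest (P ++ʷ Q) → Shortest Q
  Shortest-suffix P Q sh R = +-cancelˡ-≤ (len P) (len Q) (len R)
    (subst₂ _≤_ (len-++ʷ P Q) (len-++ʷ P R) (sh (P ++ʷ R)))

  Between : Fin k → Fin k → Fin k → Set
  Between a b c = Σ (Walk Γ a c) λ Q → Shortest Q × b ∈ᴸ verts Q

  between-from-source : ∀ {u y v w} (P : Walk Γ u y) → Shortest P → v ∈ᴸ verts P → w ∈ᴸ verts P →
    Between u v w ⊎ Between u w v
  between-from-source P sh v∈ w∈ with splitAtVertex P v∈
  ... | P₁ , P₂ , refl with ∈-++ʷ⁻ P₁ P₂ w∈
  ... | inj₁ w∈P₁ = inj₂ (P₁ , Shortest-prefix P₁ P₂ sh , w∈P₁)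
  ... | inj₂ w∈P₂ with splitAtVertex P₂ w∈P₂
  ... | Q₁ , Q₂ , refl =
    inj₁ (P₁ ++ʷ Q₁ , Shortest-prefix (P₁ ++ʷ Q₁) Q₂ sh′ , ∈-++ʷ⁺ˡ P₁ Q₁ (target∈verts P₁))
    where
      sh′ : Shortest ((P₁ ++ʷ Q₁) ++ʷ Q₂)
      sh′ = subst Shortest (sym (++ʷ-assoc P₁ Q₁ Q₂)) sh

  SomeBetween : Fin k → Fin k → Fin k → Set
  SomeBetween u v w = Between u v w ⊎ Between u w v ⊎ Between v u w ⊎ Between v w u ⊎ Between w u v ⊎ Between w v u

  three-on-shortest⇒SomeBetween : ∀ {x y u v w} (P : Walk Γ x y) → Shortest P →
    u ∈ᴸ verts P → v ∈ᴸ verts P → w ∈ᴸ verts P → u ≢ v → SomeBetween u v w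
  three-on-shortest⇒SomeBetween stop sh (here refl) (here refl) w∈ u≢v = ⊥-elim (u≢v refl)
  three-on-shortest⇒SomeBetween P@(step _ _) sh (here refl) v∈ w∈ u≢v with between-from-source P sh v∈ w∈
  ... | inj₁ b = inj₁ b
  ... | inj₂ b = inj₂ (inj₁ b)
  three-on-shortest⇒SomeBetween P@(step _ _) sh u∈@(there _) (here refl) w∈ u≢v with between-from-source P sh u∈ w∈
  ... | inj₁ b = inj₂ (inj₂ (inj₁ b))
  ... | inj₂ b = inj₂ (inj₂ (inj₂ (inj₁ b)))
  three-on-shortest⇒SomeBetween P@(step _ _) sh u∈@(there _) v∈@(there _) (here refl) u≢v
    with between-from-source P sh u∈ v∈
  ... | inj₁ b = inj₂ (inj₂ (inj₂ (inj₂ (inj₁ b))))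
  ... | inj₂ b = inj₂ (inj₂ (inj₂ (inj₂ (inj₂ b))))
  three-on-shortest⇒SomeBetween (step e P) sh (there u∈) (there v∈) (there w∈) u≢v =
    three-on-shortest⇒SomeBetween P (Shortest-suffix (step e stop) P sh) u∈ v∈ w∈ u≢v

  BetweenFree : Subset k → Set
  BetweenFree S = ∀ {a b c} → a ∈ S → b ∈ S → c ∈ S → a ≢ b → b ≢ c → a ≢ c → ¬ Between a b c

  BetweenFree⇒GenPos : ∀ {S} → BetweenFree S → GenPos Γ S
  BetweenFree⇒GenPos free u v w u∈ v∈ w∈ u≢v v≢w u≢w (_ , _ , P , sh , u∈P , v∈P , w∈P)
    with three-on-shortest⇒SomeBetween P sh u∈P v∈P w∈P u≢v
  ... | inj₁ b = free u∈ v∈ w∈ u≢v v≢w u≢w b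
  ... | inj₂ (inj₁ b) = free u∈ w∈ v∈ u≢w (v≢w ∘ sym) u≢v b
  ... | inj₂ (inj₂ (inj₁ b)) = free v∈ u∈ w∈ (u≢v ∘ sym) u≢w v≢w b
  ... | inj₂ (inj₂ (inj₂ (inj₁ b))) = free v∈ w∈ u∈ v≢w (u≢w ∘ sym) (u≢v ∘ sym) b
  ... | inj₂ (inj₂ (inj₂ (inj₂ (inj₁ b)))) = free w∈ u∈ v∈ (u≢w ∘ sym) u≢v (v≢w ∘ sym) b
  ... | inj₂ (inj₂ (inj₂ (inj₂ (inj₂ b)))) = free w∈ v∈ u∈ (v≢w ∘ sym) (u≢v ∘ sym) (u≢w ∘ sym) b

  GenPos⇒BetweenFree : ∀ {S} → GenPos Γ S → BetweenFree S
  GenPos⇒BetweenFree gp {a} {b} {c} a∈ b∈ c∈ a≢b b≢c a≢c (Q , sh , b∈Q) =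
    gp a b c a∈ b∈ c∈ a≢b b≢c a≢c (a , c , Q , sh , source∈verts Q , b∈Q , target∈verts Q)

  walk≤? : ∀ j x y → Dec (Σ (Walk Γ x y) λ P → len P ≤ j)
  walk≤? j x y with x ≟ y
  ... | yes refl = yes (stop , z≤n)
  walk≤? zero x y | no x≢y = no λ { (stop , _) → x≢y refl ; (step _ _ , ()) }
  walk≤? (suc j) x y | no x≢y with any? (λ z → T? (Γ x z) ×-dec walk≤? j z y)
  ... | yes (z , e , P , P≤j) = yes (step e P , s≤s P≤j)
  ... | no ∄z = no λ { (stop , _) → x≢y refl ; (step e P , s≤s P≤j) → ∄z (_ , e , P , P≤j) }

  shortest-below : ∀ j {x y} (P : Walk Γ x y) → len P ≤ j → Σ (Walk Γ x y) Shortest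
  shortest-below zero P P≤0 = P , λ Q → ≤-trans P≤0 z≤n
  shortest-below (suc j) {x} {y} P P≤1+j with walk≤? j x y
  ... | yes (P′ , P′≤j) = shortest-below j P′ P′≤j
  ... | no ∄P′ = P , P-shortest
    where
      P-shortest : Shortest P
      P-shortest Q with len P ≤? len Q
      ... | yes P≤Q = P≤Q
      ... | no P≰Q = ⊥-elim (∄P′ (Q , ≤-pred (≤-trans (≰⇒> P≰Q) P≤1+j)))

  shortest : ∀ {x y} → Walk Γ x y → Σ (Walk Γ x y) Shortest
  shortest P = shortest-below (len P) P ≤-refl

  distinct⇒1≤len : ∀ {a b} → a ≢ b → (R : Walk Γ a b) → 1 ≤ len R
  distinct⇒1≤len a≢b stop       = ⊥-elim (a≢b refl)
  distinct⇒1≤len a≢b (step _ _) = s≤s z≤n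

  nonadjacent⇒2≤len : ∀ {a b} → a ≢ b → ¬ T (Γ a b) → (R : Walk Γ a b) → 2 ≤ len R
  nonadjacent⇒2≤len a≢b ¬ab stop                = ⊥-elim (a≢b refl)
  nonadjacent⇒2≤len a≢b ¬ab (step e stop)       = ⊥-elim (¬ab e)
  nonadjacent⇒2≤len a≢b ¬ab (step _ (step _ _)) = s≤s (s≤s z≤n)

  len≤1⇒endpoint : ∀ {x y b} (Q : Walk Γ x y) → len Q ≤ 1 → b ∈ᴸ verts Q → b ≡ x ⊎ b ≡ y
  len≤1⇒endpoint stop          _ (here refl)         = inj₁ refl
  len≤1⇒endpoint (step e stop) _ (here refl)         = inj₁ refl
  len≤1⇒endpoint (step e stop) _ (there (here refl)) = inj₂ refl
  len≤1⇒endpoint (step e (step _ _)) (s≤s ()) _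

  adjacent⇒Between-endpoint : ∀ {a b c} → T (Γ a c) → Between a b c → b ≡ a ⊎ b ≡ c
  adjacent⇒Between-endpoint e (Q , sh , b∈Q) = len≤1⇒endpoint Q (sh (step e stop)) b∈Q

module _ {k : ℕ} {Γ : Graph k} {x x′ y y′ : Fin k} where

  len-subst₂ : (p : x ≡ x′) (q : y ≡ y′) (P : Walk Γ x y) → len (subst₂ (Walk Γ) p q P) ≡ len P
  len-subst₂ refl refl P = refl

  verts-subst₂ : (p : x ≡ x′) (q : y ≡ y′) (P : Walk Γ x y) → verts (subst₂ (Walk Γ) p q P) ≡ verts P
  verts-subst₂ refl refl P = refl

module WeakHomomorphism {k k′ : ℕ} {Γ : Graph k} {Γ′ : Graph k′} (f : Fin k → Fin k′)
  (weak : ∀ {a b} → T (Γ a b) → f a ≡ f b ⊎ T (Γ′ (f a) (f b))) where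

  mapʷ : ∀ {x y} → Walk Γ x y → Walk Γ′ (f x) (f y)
  mapʷ stop = stop
  mapʷ (step e P) with weak e
  ... | inj₁ eq = subst₂ (Walk Γ′) (sym eq) refl (mapʷ P)
  ... | inj₂ e′ = step e′ (mapʷ P)

  len-mapʷ : ∀ {x y} (P : Walk Γ x y) → len (mapʷ P) ≤ len P
  len-mapʷ stop = z≤n
  len-mapʷ (step e P) with weak e
  ... | inj₁ eq = ≤-trans (≤-reflexive (len-subst₂ (sym eq) refl (mapʷ P))) (≤-trans (len-mapʷ P) (n≤1+n _))
  ... | inj₂ e′ = s≤s (len-mapʷ P)

  ∈-mapʷ⁺ : ∀ {x y a} (P : Walk Γ x y) → a ∈ᴸ verts P → f a ∈ᴸ verts (mapʷ P)
  ∈-mapʷ⁺ stop (here refl) = here refl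
  ∈-mapʷ⁺ (step e P) a∈ with weak e | a∈
  ... | inj₁ eq | here refl = WalkProperties.source∈verts Γ′ (subst₂ (Walk Γ′) (sym eq) refl (mapʷ P))
  ... | inj₁ eq | there a∈P = subst (_ ∈ᴸ_) (sym (verts-subst₂ (sym eq) refl (mapʷ P))) (∈-mapʷ⁺ P a∈P)
  ... | inj₂ e′ | here refl = here refl
  ... | inj₂ e′ | there a∈P = there (∈-mapʷ⁺ P a∈P)

  ∈-mapʷ⁻ : ∀ {x y v} (P : Walk Γ x y) → v ∈ᴸ verts (mapʷ P) → Σ (Fin k) λ a → v ≡ f a
  ∈-mapʷ⁻ stop (here refl) = _ , refl
  ∈-mapʷ⁻ (step e P) v∈ with weak e
  ... | inj₁ eq = ∈-mapʷ⁻ P (subst (_ ∈ᴸ_) (verts-subst₂ (sym eq) refl (mapʷ P)) v∈)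
  ∈-mapʷ⁻ (step e P) (here refl)  | inj₂ e′ = _ , refl
  ∈-mapʷ⁻ (step e P) (there v∈P) | inj₂ e′ = ∈-mapʷ⁻ P v∈P

module _ {k k′ : ℕ} {Γ : Graph k} {Γ′ : Graph k′}
  {f : Fin k → Fin k′} (weak-f : ∀ {a b} → T (Γ a b) → f a ≡ f b ⊎ T (Γ′ (f a) (f b)))
  {g : Fin k′ → Fin k} (weak-g : ∀ {a b} → T (Γ′ a b) → g a ≡ g b ⊎ T (Γ (g a) (g b))) where
  open WalkProperties using (Between)
  private
    module F = WeakHomomorphism {Γ = Γ} {Γ′} f weak-f
    module G = WeakHomomorphism {Γ = Γ′} {Γ} g weak-g

  Between-map : ∀ {x b z} → Between Γ x b z → g (f x) ≡ x → g (f z) ≡ z → Between Γ′ (f x) (f b) (f z)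
  Between-map (Q , sh , b∈Q) gfx gfz = F.mapʷ Q , F-shortest , F.∈-mapʷ⁺ Q b∈Q
    where
      open ≤-Reasoning
      F-shortest : Shortest (F.mapʷ Q)
      F-shortest R = begin
        len (F.mapʷ Q)                               ≤⟨ F.len-mapʷ Q ⟩
        len Q                                        ≤⟨ sh (subst₂ (Walk Γ) gfx gfz (G.mapʷ R)) ⟩
        len (subst₂ (Walk Γ) gfx gfz (G.mapʷ R))    ≡⟨ len-subst₂ gfx gfz (G.mapʷ R) ⟩
        len (G.mapʷ R)                               ≤⟨ G.len-mapʷ R ⟩
        len R                                        ∎

LegalMove-GenPos : ∀ {k} {Γ : Graph k} {X Y} → LegalMove Γ X Y → GenPos Γ Y
LegalMove-GenPos (_ , _ , _ , _ , _ , _ , gp) = gp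

module Robots {k : ℕ} (Γ : Graph k) where

  infixr 5 _▸_ _++ᴿ_

  data Run : Subset k → Subset k → List (Subset k) → Set where
    done : ∀ {X} → Run X X []
    _▸_  : ∀ {X Y Z cs} → LegalMove Γ X Y → Run Y Z cs → Run X Z (Y ∷ cs)

  _++ᴿ_ : ∀ {X Y Z cs ds} → Run X Y cs → Run Y Z ds → Run X Z (cs ++ ds)
  done     ++ᴿ r = r
  (m ▸ r₁) ++ᴿ r = m ▸ (r₁ ++ᴿ r)

  Run-++-Chain : ∀ {X Y cs ds} → Run X Y cs → Chain Γ Y ds → Chain Γ X (cs ++ ds)
  Run-++-Chain done    ch = ch
  Run-++-Chain (m ▸ r) ch = m , Run-++-Chain r ch

  Visited : Fin k → List (Subset k) → Set
  Visited p = Any (p ∈_)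

  Visited-++⁺ˡ : ∀ {p X ds es} → Visited p (X ∷ ds) → Visited p (X ∷ ds ++ es)
  Visited-++⁺ˡ (here p∈X) = here p∈X
  Visited-++⁺ˡ (there v)  = there (++⁺ˡ v)

  Visited-++⁺ʳ : ∀ {p X} ds {es} → Visited p (X ∷ es) → Visited p (X ∷ ds ++ es)
  Visited-++⁺ʳ ds (here p∈X) = here p∈X
  Visited-++⁺ʳ ds (there v)  = there (++⁺ʳ ds v)

  Tour : Subset k → (Fin k → Set) → Set
  Tour X P = Σ (List (Subset k)) λ ds → Run X X ds × (∀ {p} → P p → Visited p (X ∷ ds))

  module _ {X : Subset k} where

    infixr 5 _⊕_

    stay : Tour X (_∈ X)
    stay = [] , done , here

    Tour-mono : ∀ {P Q : Fin k → Set} → (∀ {p} → Q p → P p) → Tour X P → Tour X Q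
    Tour-mono Q⇒P (ds , r , vis) = ds , r , vis ∘ Q⇒P

    _⊕_ : ∀ {P Q : Fin k → Set} → Tour X P → Tour X Q → Tour X (λ p → P p ⊎ Q p)
    (ds , r , visP) ⊕ (es , r′ , visQ) =
      ds ++ es , r ++ᴿ r′ , λ { (inj₁ Pp) → Visited-++⁺ˡ (visP Pp) ; (inj₂ Qp) → Visited-++⁺ʳ ds (visQ Qp) }

    tour-⋃ : ∀ {n} {P : Fin n → Fin k → Set} → (∀ i → Tour X (P i)) → Tour X (λ p → Σ (Fin n) λ i → P i p)
    tour-⋃ {zero}  t = Tour-mono (λ { (() , _) }) stay
    tour-⋃ {suc n} t =
      Tour-mono (λ { (zero , q) → inj₁ q ; (suc i , q) → inj₂ (i , q) }) (t zero ⊕ tour-⋃ (t ∘ suc))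

  LegalMove⇒∣∣≤ : ∀ {X Y} → LegalMove Γ X Y → ∣ X ∣ ≤ ∣ Y ∣
  LegalMove⇒∣∣≤ {X} (u , v , u∈X , v∉X , _ , refl , _) = injection⇒∣∣≤ X (shift X u v) swap into inj
    where
      swap : Fin k → Fin k
      swap p with p ≟ u
      ... | yes _ = v
      ... | no _  = p
      into : ∀ {p} → p ∈ X → swap p ∈ shift X u v
      into {p} p∈X with p ≟ u
      ... | yes _   = target∈shift
      ... | no p≢u = ∈-shift⁺ p≢u p∈X
      inj : ∀ {p q} → p ∈ X → q ∈ X → swap p ≡ swap q → p ≡ q
      inj {p} {q} p∈X q∈X eq with p ≟ u | q ≟ u
      ... | yes p≡u | yes q≡u = trans p≡u (sym q≡u)
      ... | yes _   | no _    = ⊥-elim (v∉X (subst (_∈ X) (sym eq) q∈X))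
      ... | no _    | yes _   = ⊥-elim (v∉X (subst (_∈ X) eq p∈X))
      ... | no _    | no _    = eq

  module Excursions (loopless : ∀ v → Γ v v ≡ false) where

    adjacent⇒distinct : ∀ {u v} → T (Γ u v) → u ≢ v
    adjacent⇒distinct {u} e refl = subst T (loopless u) e

    -- the robot from a may stand at v while all other robots of X stay where they are
    SafeStop : Subset k → Fin k → Fin k → Set
    SafeStop X a v = v ∉ X [ a ]≔ outside × GenPos Γ (shift X a v)

    shift-step : ∀ {X a v w} → T (Γ v w) → SafeStop X a v → SafeStop X a w →
      LegalMove Γ (shift X a v) (shift X a w)
    shift-step {X} {a} {v} {w} e (v∉ , _) (w∉ , gp) =
      v , w , target∈shift , w∉shift , e , sym (shift-shift v∉) , gp
      where
        w∉shift : w ∉ shift X a v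
        w∉shift = w∉ ∘ ∈-≔⁻ (adjacent⇒distinct e ∘ sym)

    excursion : ∀ {X a w₀ w₁} (P : Walk Γ w₀ w₁) → (∀ {v} → v ∈ᴸ verts P → SafeStop X a v) →
      Σ (List (Subset k)) λ ds → Run (shift X a w₀) (shift X a w₁) ds ×
        (∀ {v} → v ∈ᴸ verts P → Visited v (shift X a w₀ ∷ ds))
    excursion stop safe = [] , done , λ { (here refl) → here target∈shift }
    excursion {X} {a} (step {y = z} e P) safe with excursion P (safe ∘ there)
    ... | ds , r , vis = shift X a z ∷ ds ,
          shift-step e (safe (here refl)) (safe (there (WalkProperties.source∈verts Γ P))) ▸ r ,
          λ { (here refl) → here target∈shift ; (there v∈P) → there (vis v∈P) }

    closed-excursion : ∀ {X a} → a ∈ X → (P : Walk Γ a a) → (∀ {v} → v ∈ᴸ verts P → SafeStop X a v) →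
      Tour X (_∈ᴸ verts P)
    closed-excursion {X} {a} a∈X P safe with excursion P safe
    ... | ds , r , vis = ds , subst₂ (λ Y Z → Run Y Z ds) back back r , subst (λ Y → Visited _ (Y ∷ ds)) back ∘ vis
      where
        back : shift X a a ≡ X
        back = shift-refl a∈X

module Embedding {k k′ : ℕ} {Γ : Graph k} {Γ′ : Graph k′}
  (ε : Fin k → Fin k′) (ρ : Fin k′ → Fin k) (ρ∘ε : ∀ a → ρ (ε a) ≡ a)
  (ε-hom : ∀ {a b} → T (Γ a b) → T (Γ′ (ε a) (ε b)))
  (Between-reflect : ∀ {a b c} → WalkProperties.Between Γ′ (ε a) (ε b) (ε c) → WalkProperties.Between Γ a b c)
  where
  open Robots Γ′ using (Tour; Visited; Visited-++⁺ˡ; Run-++-Chain)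

  image : Subset k → Subset k′
  image X = tabulate (λ p → ⌊ ε (ρ p) ≟ p ⌋ ∧ lookup X (ρ p))

  ε-injective : ∀ {a b} → ε a ≡ ε b → a ≡ b
  ε-injective {a} {b} eq = trans (sym (ρ∘ε a)) (trans (cong ρ eq) (ρ∘ε b))

  ∈-image⁺ : ∀ {X a} → a ∈ X → ε a ∈ image X
  ∈-image⁺ {X} {a} a∈X = ∈-tabulate⁺ (begin
    ⌊ ε (ρ (ε a)) ≟ ε a ⌋ ∧ lookup X (ρ (ε a))  ≡⟨ cong (λ b → ⌊ ε b ≟ ε a ⌋ ∧ lookup X b) (ρ∘ε a) ⟩
    ⌊ ε a ≟ ε a ⌋ ∧ lookup X a                  ≡⟨ cong₂ _∧_ (⌊≟⌋-refl (ε a)) ([]=⇒lookup a∈X) ⟩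
    true                                        ∎)
    where open ≡-Reasoning

  ∈-image⁻ : ∀ {X p} → p ∈ image X → Σ (Fin k) λ a → p ≡ ε a × a ∈ X
  ∈-image⁻ {X} {p} p∈ with ε (ρ p) ≟ p | ∈-tabulate⁻ p∈
  ... | yes ερp≡p | ρp∈X = ρ p , sym ερp≡p , lookup⇒[]= (ρ p) X ρp∈X

  image-GenPos : ∀ {X} → GenPos Γ X → GenPos Γ′ (image X)
  image-GenPos {X} gp = WalkProperties.BetweenFree⇒GenPos Γ′ free
    where
      free : WalkProperties.BetweenFree Γ′ (image X)
      free p∈ q∈ s∈ p≢q q≢s p≢s btw with ∈-image⁻ p∈ | ∈-image⁻ q∈ | ∈-image⁻ s∈
      ... | a , refl , a∈X | b , refl , b∈X | c , refl , c∈X =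
        WalkProperties.GenPos⇒BetweenFree Γ gp a∈X b∈X c∈X
          (p≢q ∘ cong ε) (q≢s ∘ cong ε) (p≢s ∘ cong ε) (Between-reflect btw)

  image-shift : ∀ {X u v} → image (shift X u v) ≡ shift (image X) (ε u) (ε v)
  image-shift {X} {u} {v} = ⊆-antisym ⊆ ⊇
    where
      ⊆ : ∀ {p} → p ∈ image (shift X u v) → p ∈ shift (image X) (ε u) (ε v)
      ⊆ p∈ with ∈-image⁻ p∈
      ... | a , refl , a∈ with ∈-shift⁻ {S = X} {u} {v} a∈
      ... | inj₁ refl = target∈shift {S = image X}
      ... | inj₂ (a≢u , a∈X) = ∈-shift⁺ (a≢u ∘ ε-injective) (∈-image⁺ {X} a∈X)
      ⊇ : ∀ {p} → p ∈ shift (image X) (ε u) (ε v) → p ∈ image (shift X u v)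
      ⊇ p∈ with ∈-shift⁻ {S = image X} {ε u} {ε v} p∈
      ... | inj₁ refl = ∈-image⁺ {shift X u v} (target∈shift {S = X})
      ... | inj₂ (p≢εu , p∈X) with ∈-image⁻ {X} p∈X
      ... | a , refl , a∈X = ∈-image⁺ {shift X u v} (∈-shift⁺ (p≢εu ∘ cong ε) a∈X)

  image-LegalMove : ∀ {X Y} → LegalMove Γ X Y → LegalMove Γ′ (image X) (image Y)
  image-LegalMove {X} (u , v , u∈X , v∉X , e , refl , gp) =
    ε u , ε v , ∈-image⁺ u∈X , εv∉ , ε-hom e , image-shift {X} , image-GenPos gp
    where
      εv∉ : ε v ∉ image X
      εv∉ εv∈ with ∈-image⁻ εv∈
      ... | a , εv≡εa , a∈X = v∉X (subst (_∈ X) (sym (ε-injective εv≡εa)) a∈X)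

  ∣image∣ : ∀ X → ∣ X ∣ ≤ ∣ image X ∣
  ∣image∣ X = injection⇒∣∣≤ X (image X) ε ∈-image⁺ (λ _ _ → ε-injective)

  -- A mobile S visits ρ p for every p, so inserting at each configuration X a tour through
  -- the fibres of X under ρ makes the image visit every vertex of Γ′.
  module _ (tour : ∀ {X} → GenPos Γ X → Tour (image X) (λ p → ρ p ∈ X)) where

    image-Chain : ∀ {S cs} → GenPos Γ S → Chain Γ S cs →
      Σ (List (Subset k′)) λ ds → Chain Γ′ (image S) ds ×
        (∀ {p} → Any (ρ p ∈_) (S ∷ cs) → Visited p (image S ∷ ds))
    image-Chain {S} {[]} gp _ with tour gp
    ... | ds , r , vis = ds ++ [] , Run-++-Chain r tt , λ { (here ρp∈S) → Visited-++⁺ˡ (vis ρp∈S) }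
    image-Chain {S} {Y ∷ cs} gp (m , ch) with tour gp | image-Chain (LegalMove-GenPos m) ch
    ... | ds , r , vis | es , ch′ , vis′ =
      ds ++ image Y ∷ es , Run-++-Chain r (image-LegalMove m , ch′) ,
      λ { (here ρp∈S) → Visited-++⁺ˡ (vis ρp∈S) ; (there a) → there (++⁺ʳ ds (vis′ a)) }

    image-Mobile : ∀ {S} → Mobile Γ S → Mobile Γ′ (image S)
    image-Mobile {S} (gp , cs , ch , covers) with image-Chain gp ch
    ... | ds , ch′ , vis = image-GenPos gp , ds , ch′ , λ p → vis (covers (ρ p))

module Corona {n m : ℕ} (G : Graph n) (H : Graph m) where

  N : ℕ
  N = n + n * m

  C : Graph N
  C = corona G H

  -- ι i is the vertex v_i of the paper and h i x the vertex x of the copy H^i.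
  ι : Fin n → Fin N
  ι i = i ↑ˡ (n * m)

  h : Fin n → Fin m → Fin N
  h i x = n ↑ʳ combine i x

  data View : Fin N → Set where
    base  : ∀ i → View (ι i)
    fibre : ∀ i x → View (h i x)

  view : ∀ p → View p
  view p with splitAt n p in eq
  ... | inj₁ i = subst View (splitAt⁻¹-↑ˡ eq) (base i)
  ... | inj₂ q = subst View (trans (cong (n ↑ʳ_) (combine-remQuot {n} m q)) (splitAt⁻¹-↑ʳ eq))
                   (fibre (proj₁ (remQuot {n} m q)) (proj₂ (remQuot {n} m q)))

  splitAt-ι : ∀ i → splitAt n (ι i) ≡ inj₁ i
  splitAt-ι i = splitAt-↑ˡ n i (n * m)

  splitAt-h : ∀ i x → splitAt n (h i x) ≡ inj₂ (combine i x)
  splitAt-h i x = splitAt-↑ʳ n (n * m) (combine i x)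

  adj-ιι : ∀ i j → C (ι i) (ι j) ≡ G i j
  adj-ιι i j rewrite splitAt-ι i | splitAt-ι j = refl

  adj-ιh : ∀ i j x → C (ι i) (h j x) ≡ ⌊ i ≟ j ⌋
  adj-ιh i j x rewrite splitAt-ι i | splitAt-h j x = cong (λ r → ⌊ i ≟ proj₁ r ⌋) (remQuot-combine j x)

  adj-hι : ∀ i x j → C (h i x) (ι j) ≡ ⌊ i ≟ j ⌋
  adj-hι i x j rewrite splitAt-h i x | splitAt-ι j = cong (λ r → ⌊ proj₁ r ≟ j ⌋) (remQuot-combine i x)

  adj-hh : ∀ i x j y → C (h i x) (h j y) ≡ ⌊ i ≟ j ⌋ ∧ H x y
  adj-hh i x j y rewrite splitAt-h i x | splitAt-h j y =
    cong₂ (λ r r′ → ⌊ proj₁ r ≟ proj₁ r′ ⌋ ∧ H (proj₂ r) (proj₂ r′))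
          (remQuot-combine i x) (remQuot-combine j y)

  π : Fin N → Fin n
  π p = [ (λ i → i) , (λ q → proj₁ (remQuot {n} m q)) ]′ (splitAt n p)

  π-ι : ∀ i → π (ι i) ≡ i
  π-ι i rewrite splitAt-ι i = refl

  π-h : ∀ i x → π (h i x) ≡ i
  π-h i x rewrite splitAt-h i x = cong proj₁ (remQuot-combine i x)

  h-injective : ∀ {i x j y} → h i x ≡ h j y → i ≡ j × x ≡ y
  h-injective {i} {x} {j} {y} eq = combine-injective i x j y (↑ʳ-injective n _ _ eq)

  ι≢h : ∀ {i j x} → ι i ≢ h j x
  ι≢h {i} {j} {x} eq with trans (sym (splitAt-ι i)) (trans (cong (splitAt n) eq) (splitAt-h j x))
  ... | ()

  ιι-edge⁺ : ∀ {i j} → T (G i j) → T (C (ι i) (ι j))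
  ιι-edge⁺ {i} {j} = subst T (sym (adj-ιι i j))

  ιι-edge⁻ : ∀ {i j} → T (C (ι i) (ι j)) → T (G i j)
  ιι-edge⁻ {i} {j} = subst T (adj-ιι i j)

  ιh-edge : ∀ i x → T (C (ι i) (h i x))
  ιh-edge i x = subst T (sym (trans (adj-ιh i i x) (⌊≟⌋-refl i))) tt

  hι-edge : ∀ i x → T (C (h i x) (ι i))
  hι-edge i x = subst T (sym (trans (adj-hι i x i) (⌊≟⌋-refl i))) tt

  hh-edge⁺ : ∀ i {x y} → T (H x y) → T (C (h i x) (h i y))
  hh-edge⁺ i {x} {y} = subst T (sym (trans (adj-hh i x i y) (cong (_∧ H x y) (⌊≟⌋-refl i))))

  ιh-edge⁻ : ∀ {i j x} → T (C (ι i) (h j x)) → i ≡ j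
  ιh-edge⁻ {i} {j} {x} e = toWitness (subst T (adj-ιh i j x) e)

  hι-edge⁻ : ∀ {i x j} → T (C (h i x) (ι j)) → i ≡ j
  hι-edge⁻ {i} {x} {j} e = toWitness (subst T (adj-hι i x j) e)

  hh-edge⁻ : ∀ {i x j y} → T (C (h i x) (h j y)) → i ≡ j × T (H x y)
  hh-edge⁻ {i} {x} {j} {y} e with i ≟ j | subst T (adj-hh i x j y) e
  ... | yes i≡j | Hxy = i≡j , Hxy

  π-weak : ∀ {p q} → T (C p q) → π p ≡ π q ⊎ T (G (π p) (π q))
  π-weak {p} {q} e with view p | view q
  ... | base i    | base j    rewrite π-ι i | π-ι j = inj₂ (ιι-edge⁻ e)
  ... | base i    | fibre j y rewrite π-ι i | π-h j y = inj₁ (ιh-edge⁻ e)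
  ... | fibre i x | base j    rewrite π-h i x | π-ι j = inj₁ (hι-edge⁻ e)
  ... | fibre i x | fibre j y rewrite π-h i x | π-h j y = inj₁ (proj₁ (hh-edge⁻ e))

  ι-weak : ∀ {a b} → T (G a b) → ι a ≡ ι b ⊎ T (C (ι a) (ι b))
  ι-weak = inj₂ ∘ ιι-edge⁺

  corona-loopless : (∀ i → G i i ≡ false) → (∀ x → H x x ≡ false) → ∀ p → C p p ≡ false
  corona-loopless G-loopless H-loopless p with view p
  ... | base i    = trans (adj-ιι i i) (G-loopless i)
  ... | fibre i x = trans (adj-hh i x i x) (trans (cong (_∧ H x x) (⌊≟⌋-refl i)) (H-loopless x))

  InCopy : Fin n → Fin N → Set
  InCopy i p = Σ (Fin m) λ x → p ≡ h i x

  InCopy? : ∀ i p → Dec (InCopy i p)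
  InCopy? i p with view p
  ... | base j = no λ (_ , eq) → ι≢h eq
  ... | fibre j y with j ≟ i
  ...   | yes refl = yes (y , refl)
  ...   | no j≢i  = no λ (_ , eq) → j≢i (proj₁ (h-injective eq))

  ¬InCopy-ι : ∀ {i j} → ¬ InCopy j (ι i)
  ¬InCopy-ι (_ , eq) = ι≢h eq

  module BaseWalks (G-connected : Connected G) where
    private module ι* = WeakHomomorphism {Γ = G} {Γ′ = C} ι ι-weak

    base-walk : ∀ j k → Walk C (ι j) (ι k)
    base-walk j k = ι*.mapʷ (G-connected j k)

    base-walk-avoids-copies : ∀ {i j k v} → v ∈ᴸ verts (base-walk j k) → ¬ InCopy i v
    base-walk-avoids-copies {j = j} {k} v∈ with ι*.∈-mapʷ⁻ (G-connected j k) v∈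
    ... | _ , refl = ¬InCopy-ι

  open WalkProperties C

  leaving-copy-visits-ι : ∀ {p q} i (P : Walk C p q) → InCopy i p → ¬ InCopy i q → ι i ∈ᴸ verts P
  leaving-copy-visits-ι i stop p∈ q∉ = ⊥-elim (q∉ p∈)
  leaving-copy-visits-ι i (step {y = z} e P) (x , refl) q∉ with view z
  ... | base j    rewrite sym (hι-edge⁻ e) = there (source∈verts P)
  ... | fibre j y rewrite sym (proj₁ (hh-edge⁻ e)) = there (leaving-copy-visits-ι i P (y , refl) q∉)

  entering-copy-visits-ι : ∀ {p q} i (P : Walk C p q) → ¬ InCopy i p → InCopy i q → ι i ∈ᴸ verts P
  entering-copy-visits-ι i stop p∉ q∈ = ⊥-elim (p∉ q∈)
  entering-copy-visits-ι {p} i (step {y = z} e P) p∉ q∈ with InCopy? i z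
  ... | no z∉ = there (entering-copy-visits-ι i P z∉ q∈)
  ... | yes (y , refl) with view p
  ...   | base j    rewrite ιh-edge⁻ e = here refl
  ...   | fibre j x = ⊥-elim (p∉ (x , cong (λ k → h k x) (proj₁ (hh-edge⁻ e))))

  Between-exit : ∀ {j x z b} (Q : Walk C (h j x) z) → Shortest Q → b ∈ᴸ verts Q → ¬ InCopy j b → Between (ι j) b z
  Between-exit {j} {x} Q sh b∈Q b∉ with splitAtVertex Q b∈Q
  ... | A , B , refl with splitAtVertex A (leaving-copy-visits-ι j A (x , refl) b∉)
  ... | A₁ , A₂ , refl = A₂ ++ʷ B , Shortest-suffix A₁ (A₂ ++ʷ B) (subst Shortest (++ʷ-assoc A₁ A₂ B) sh) ,
                         ∈-++ʷ⁺ˡ A₂ B (target∈verts A₂)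

  Between-entry : ∀ {j x z b} (Q : Walk C z (h j x)) → Shortest Q → b ∈ᴸ verts Q → ¬ InCopy j b → Between z b (ι j)
  Between-entry {j} {x} Q sh b∈Q b∉ with splitAtVertex Q b∈Q
  ... | A , B , refl with splitAtVertex B (entering-copy-visits-ι j B b∉ (x , refl))
  ... | B₁ , B₂ , refl = A ++ʷ B₁ , Shortest-prefix (A ++ʷ B₁) B₂ (subst Shortest (sym (++ʷ-assoc A B₁ B₂)) sh) ,
                         ∈-++ʷ⁺ˡ A B₁ (target∈verts A)

module LowerBoundFromG {n m : ℕ} (G : Graph n) (H : Graph m)
  (G-loopless : ∀ i → G i i ≡ false) (H-loopless : ∀ x → H x x ≡ false) where
  open Corona G H
  open WalkProperties using (Between; BetweenFree; BetweenFree⇒GenPos; GenPos⇒BetweenFree)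
  open Robots C using (Tour; stay; Tour-mono; _⊕_; tour-⋃)
  open Robots.Excursions C (corona-loopless G-loopless H-loopless)

  Between-π : ∀ {a b c} → Between C (ι a) b (ι c) → Between G a (π b) c
  Between-π {a} {b} {c} btw = subst₂ (λ a′ c′ → Between G a′ (π b) c′) (π-ι a) (π-ι c)
    (Between-map π-weak ι-weak btw (cong ι (π-ι a)) (cong ι (π-ι c)))

  Between-ι-reflect : ∀ {a b c} → Between C (ι a) (ι b) (ι c) → Between G a b c
  Between-ι-reflect {a} {b} {c} = subst (λ v → Between G a v c) (π-ι b) ∘ Between-π

  open Embedding ι π π-ι ιι-edge⁺ Between-ι-reflect public

  h∉image : ∀ {X j x} → h j x ∉ image X
  h∉image {X} h∈ with ∈-image⁻ {X} h∈
  ... | _ , eq , _ = ι≢h (sym eq)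

  detour-GenPos : ∀ {X j x} → GenPos G X → j ∈ X → GenPos C (shift (image X) (ι j) (h j x))
  detour-GenPos {X} {j} {x} gp j∈X = BetweenFree⇒GenPos C free
    where
      classify : ∀ {p} → p ∈ shift (image X) (ι j) (h j x) →
        p ≡ h j x ⊎ Σ (Fin n) λ a → p ≡ ι a × a ∈ X × a ≢ j
      classify p∈ with ∈-shift⁻ {S = image X} p∈
      ... | inj₁ eq = inj₁ eq
      ... | inj₂ (p≢ιj , p∈image) with ∈-image⁻ {X} p∈image
      ... | a , refl , a∈X = inj₂ (a , refl , a∈X , p≢ιj ∘ cong ι)
      free-G : BetweenFree G X
      free-G = GenPos⇒BetweenFree G gp
      free : BetweenFree C (shift (image X) (ι j) (h j x))
      free p∈ q∈ s∈ p≢q q≢s p≢s btw@(Q , sh , q∈Q) with classify p∈ | classify q∈ | classify s∈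
      ... | inj₁ refl | inj₁ refl | _         = p≢q refl
      ... | inj₁ refl | _         | inj₁ refl = p≢s refl
      ... | _         | inj₁ refl | inj₁ refl = q≢s refl
      ... | inj₂ (a , refl , a∈X , _) | inj₂ (b , refl , b∈X , _) | inj₂ (c , refl , c∈X , _) =
        free-G a∈X b∈X c∈X (p≢q ∘ cong ι) (q≢s ∘ cong ι) (p≢s ∘ cong ι) (Between-ι-reflect btw)
      ... | inj₂ (a , refl , a∈X , a≢j) | inj₁ refl | inj₂ (c , refl , c∈X , c≢j) =
        free-G a∈X j∈X c∈X a≢j (c≢j ∘ sym) (p≢s ∘ cong ι)
          (subst (λ v → Between G a v c) (π-h j x) (Between-π btw))
      ... | inj₁ refl | inj₂ (b , refl , b∈X , b≢j) | inj₂ (c , refl , c∈X , c≢j) =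
        free-G j∈X b∈X c∈X (b≢j ∘ sym) (q≢s ∘ cong ι) (c≢j ∘ sym)
          (Between-ι-reflect (Between-exit Q sh q∈Q ¬InCopy-ι))
      ... | inj₂ (a , refl , a∈X , a≢j) | inj₂ (b , refl , b∈X , b≢j) | inj₁ refl =
        free-G a∈X b∈X j∈X (p≢q ∘ cong ι) b≢j a≢j (Between-ι-reflect (Between-entry Q sh q∈Q ¬InCopy-ι))

  baseTour : ∀ {X} → GenPos G X → Tour (image X) (λ p → π p ∈ X)
  baseTour {X} gp = Tour-mono cover (stay ⊕ tour-⋃ fibreTours)
    where
      detour : ∀ {j} → j ∈ X → ∀ x → Tour (image X) (λ p → p ≡ h j x)
      detour {j} j∈X x = Tour-mono (λ { refl → there (here refl) }) (closed-excursion ιj∈ P safe)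
        where
          ιj∈ : ι j ∈ image X
          ιj∈ = ∈-image⁺ j∈X
          P : Walk C (ι j) (ι j)
          P = step (ιh-edge j x) (step (hι-edge j x) stop)
          home : SafeStop (image X) (ι j) (ι j)
          home = ∉-≔outside (ι j) , subst (GenPos C) (sym (shift-refl ιj∈)) (image-GenPos gp)
          safe : ∀ {v} → v ∈ᴸ verts P → SafeStop (image X) (ι j) v
          safe (here refl)                 = home
          safe (there (here refl))         = ∉-≔outside⁺ (h∉image {X}) , detour-GenPos gp j∈X
          safe (there (there (here refl))) = home
      fibreTours : ∀ j → Tour (image X) (λ p → Σ (Fin m) λ x → j ∈ X × p ≡ h j x)
      fibreTours j with j ∈? X
      ... | yes j∈X = Tour-mono (λ (x , _ , eq) → x , eq) (tour-⋃ (detour j∈X))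
      ... | no j∉X  = Tour-mono (λ (_ , j∈X , _) → ⊥-elim (j∉X j∈X)) stay
      cover : ∀ {p} → π p ∈ X → p ∈ image X ⊎ Σ (Fin n) λ j → Σ (Fin m) λ x → j ∈ X × p ≡ h j x
      cover {p} πp∈X with view p
      ... | base i    = inj₁ (∈-image⁺ (subst (_∈ X) (π-ι i) πp∈X))
      ... | fibre j x = inj₂ (j , x , subst (_∈ X) (π-h j x) πp∈X , refl)

  image-Mobile-base : ∀ {S} → Mobile G S → Mobile C (image S)
  image-Mobile-base = image-Mobile baseTour

module ClosedCopy {n m : ℕ} (G : Graph n) (H : Graph m) (i : Fin n) where
  open Corona G H
  open WalkProperties using (Between)

  J : Graph (m + 1)
  J = join H K₁

  hᴶ : Fin m → Fin (m + 1)
  hᴶ x = x ↑ˡ 1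

  κ : Fin (m + 1)
  κ = m ↑ʳ zero

  data JView : Fin (m + 1) → Set where
    vertex : ∀ x → JView (hᴶ x)
    apex   : JView κ

  jview : ∀ a → JView a
  jview a with splitAt m {1} a in eq
  ... | inj₁ x    = subst JView (splitAt⁻¹-↑ˡ eq) (vertex x)
  ... | inj₂ zero = subst JView (splitAt⁻¹-↑ʳ eq) apex

  private
    splitAt-hᴶ : ∀ x → splitAt m {1} (hᴶ x) ≡ inj₁ x
    splitAt-hᴶ x = splitAt-↑ˡ m x 1

    splitAt-κ : splitAt m {1} κ ≡ inj₂ zero
    splitAt-κ = splitAt-↑ʳ m 1 zero

  adjᴶ-hh : ∀ x y → J (hᴶ x) (hᴶ y) ≡ H x y
  adjᴶ-hh x y rewrite splitAt-hᴶ x | splitAt-hᴶ y = refl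

  hκ-edgeᴶ : ∀ x → T (J (hᴶ x) κ)
  hκ-edgeᴶ x rewrite splitAt-hᴶ x | splitAt-κ = tt

  κh-edgeᴶ : ∀ x → T (J κ (hᴶ x))
  κh-edgeᴶ x rewrite splitAt-hᴶ x | splitAt-κ = tt

  ¬κκ-edgeᴶ : ¬ T (J κ κ)
  ¬κκ-edgeᴶ rewrite splitAt-κ = λ ()

  hᴶ-injective : ∀ {x y} → hᴶ x ≡ hᴶ y → x ≡ y
  hᴶ-injective = ↑ˡ-injective 1 _ _

  hᴶ≢κ : ∀ {x} → hᴶ x ≢ κ
  hᴶ≢κ {x} eq with trans (sym (splitAt-hᴶ x)) (trans (cong (splitAt m) eq) splitAt-κ)
  ... | ()

  -- ε maps H ∨ K₁ onto {ι i} ∪ H^i, the apex κ going to ι i; ρ retracts G ⊙ H onto it by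
  -- collapsing everything outside H^i to the apex, which makes the copy isometric.
  ε : Fin (m + 1) → Fin N
  ε a = [ h i , (λ _ → ι i) ]′ (splitAt m a)

  ε-hᴶ : ∀ x → ε (hᴶ x) ≡ h i x
  ε-hᴶ x rewrite splitAt-hᴶ x = refl

  ε-κ : ε κ ≡ ι i
  ε-κ rewrite splitAt-κ = refl

  ρ-fibre : Fin n → Fin m → Fin (m + 1)
  ρ-fibre j x = if ⌊ i ≟ j ⌋ then hᴶ x else κ

  ρ : Fin N → Fin (m + 1)
  ρ p = [ (λ _ → κ) , (λ q → uncurry ρ-fibre (remQuot {n} m q)) ]′ (splitAt n p)

  ρ-ι : ∀ j → ρ (ι j) ≡ κ
  ρ-ι j rewrite splitAt-ι j = refl

  ρ-h : ∀ j x → ρ (h j x) ≡ ρ-fibre j x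
  ρ-h j x rewrite splitAt-h j x = cong (uncurry ρ-fibre) (remQuot-combine j x)

  ρ-h-same : ∀ x → ρ (h i x) ≡ hᴶ x
  ρ-h-same x = trans (ρ-h i x) (cong (if_then hᴶ x else κ) (⌊≟⌋-refl i))

  ρ-h-other : ∀ {j} x → i ≢ j → ρ (h j x) ≡ κ
  ρ-h-other {j} x i≢j with i ≟ j | ρ-h j x
  ... | yes i≡j | _  = ⊥-elim (i≢j i≡j)
  ... | no _    | eq = eq

  ρ∘ε : ∀ a → ρ (ε a) ≡ a
  ρ∘ε a with jview a
  ... | vertex x = trans (cong ρ (ε-hᴶ x)) (ρ-h-same x)
  ... | apex     = trans (cong ρ ε-κ) (ρ-ι i)

  ε∘ρ-closedCopy : ∀ {p} → π p ≡ i → ε (ρ p) ≡ p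
  ε∘ρ-closedCopy {p} πp≡i with view p
  ... | base j    rewrite π-ι j | πp≡i = trans (cong ε (ρ-ι i)) ε-κ
  ... | fibre j x rewrite π-h j x | πp≡i = trans (cong ε (ρ-h-same x)) (ε-hᴶ x)

  ε∘ρ-copy : ∀ {p} → InCopy i p → ε (ρ p) ≡ p
  ε∘ρ-copy (x , refl) = ε∘ρ-closedCopy (π-h i x)

  ρ-outside : ∀ {p} → ¬ InCopy i p → ρ p ≡ κ
  ρ-outside {p} p∉ with view p
  ... | base j    = ρ-ι j
  ... | fibre j x = ρ-h-other x (λ i≡j → p∉ (x , cong (λ k → h k x) (sym i≡j)))

  ε-hom : ∀ {a b} → T (J a b) → T (C (ε a) (ε b))
  ε-hom {a} {b} e with jview a | jview b
  ... | vertex x | vertex y rewrite ε-hᴶ x | ε-hᴶ y = hh-edge⁺ i (subst T (adjᴶ-hh x y) e)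
  ... | vertex x | apex     rewrite ε-hᴶ x | ε-κ = hι-edge i x
  ... | apex     | vertex y rewrite ε-hᴶ y | ε-κ = ιh-edge i y
  ... | apex     | apex     = ⊥-elim (¬κκ-edgeᴶ e)

  ε-weak : ∀ {a b} → T (J a b) → ε a ≡ ε b ⊎ T (C (ε a) (ε b))
  ε-weak = inj₂ ∘ ε-hom

  ρ-weak : ∀ {p q} → T (C p q) → ρ p ≡ ρ q ⊎ T (J (ρ p) (ρ q))
  ρ-weak {p} {q} e with view p | view q
  ... | base j | base k rewrite ρ-ι j | ρ-ι k = inj₁ refl
  ... | base j | fibre k y with ιh-edge⁻ e
  ...   | refl with i ≟ j
  ...     | yes refl rewrite ρ-ι i | ρ-h-same y = inj₂ (κh-edgeᴶ y)
  ...     | no i≢j   rewrite ρ-ι j | ρ-h-other y i≢j = inj₁ refl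
  ρ-weak e | fibre j x | base k with hι-edge⁻ e
  ...   | refl with i ≟ j
  ...     | yes refl rewrite ρ-ι i | ρ-h-same x = inj₂ (hκ-edgeᴶ x)
  ...     | no i≢j   rewrite ρ-ι j | ρ-h-other x i≢j = inj₁ refl
  ρ-weak e | fibre j x | fibre k y with hh-edge⁻ e
  ...   | refl , Hxy with i ≟ j
  ...     | yes refl rewrite ρ-h-same x | ρ-h-same y = inj₂ (subst T (sym (adjᴶ-hh x y)) Hxy)
  ...     | no i≢j   rewrite ρ-h-other x i≢j | ρ-h-other y i≢j = inj₁ refl

  Between-ε : ∀ {a b c} → Between J a b c → Between C (ε a) (ε b) (ε c)
  Between-ε btw = Between-map ε-weak ρ-weak btw (ρ∘ε _) (ρ∘ε _)

  Between-ε-reflect : ∀ {a b c} → Between C (ε a) (ε b) (ε c) → Between J a b c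
  Between-ε-reflect {a} {b} {c} btw = subst (λ v → Between J a v c) (ρ∘ε b)
    (subst₂ (λ a′ c′ → Between J a′ (ρ (ε b)) c′) (ρ∘ε a) (ρ∘ε c)
      (Between-map ρ-weak ε-weak btw (cong ε (ρ∘ε a)) (cong ε (ρ∘ε c))))

  open Embedding ε ρ ρ∘ε ε-hom Between-ε-reflect public

a+b+c≰a+1 : ∀ a {b c} → 1 ≤ b → 1 ≤ c → ¬ (a + b + c ≤ a + 1)
a+b+c≰a+1 a b≥1 c≥1 le = <⇒≱ (m<m+n (a + 1) (s≤s z≤n)) (≤-trans (+-mono-≤ (+-monoʳ-≤ a b≥1) c≥1) le)

a+b+c≰1+c : ∀ {a b} c → 1 ≤ a → 1 ≤ b → ¬ (a + (b + c) ≤ suc c)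
a+b+c≰1+c c a≥1 b≥1 le = <⇒≱ (n<1+n (suc c)) (≤-trans (+-mono-≤ a≥1 (+-monoˡ-≤ c b≥1)) le)

module LowerBoundFromJoin {n m : ℕ} (G : Graph n) (H : Graph m)
  (G-loopless : ∀ j → G j j ≡ false) (H-loopless : ∀ x → H x x ≡ false)
  (G-connected : Connected G) (i : Fin n) where
  open Corona G H
  open BaseWalks G-connected
  open ClosedCopy G H i public
  open WalkProperties using (BetweenFree; BetweenFree⇒GenPos; GenPos⇒BetweenFree; nonadjacent⇒2≤len)
  open WalkProperties C using (splitAtVertex; _++ʷ_; len-++ʷ; distinct⇒1≤len; adjacent⇒Between-endpoint;
                               target∈verts; ∈-++ʷ⁺ˡ; ∈-++ʷ⁺ʳ; ∈-++ʷ⁻)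
  open Robots C using (Tour; stay; Tour-mono; _⊕_; tour-⋃)
  open Robots.Excursions C (corona-loopless G-loopless H-loopless)

  ∈-image-apex⁻ : ∀ {X p} → p ∈ image X → p ≢ ι i → Σ (Fin m) λ x → p ≡ h i x × hᴶ x ∈ X
  ∈-image-apex⁻ {X} p∈ p≢ιi with ∈-image⁻ {X} p∈
  ... | a , refl , a∈X with jview a
  ...   | vertex x = x , ε-hᴶ x , a∈X
  ...   | apex     = ⊥-elim (p≢ιi ε-κ)

  outside∉image : ∀ {X v} → ¬ InCopy i v → v ∉ image X [ ι i ]≔ outside
  outside∉image {X} {v} v∉copy with v ≟ ι i
  ... | yes refl = ∉-≔outside (ι i)
  ... | no v≢ιi  = ∉-≔outside⁺ v∉image
    where
      v∉image : v ∉ image X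
      v∉image v∈ with ∈-image-apex⁻ {X} v∈ v≢ιi
      ... | x , eq , _ = v∉copy (x , eq)

  apex-clique : ∀ {X x y} → GenPos J X → κ ∈ X → hᴶ x ∈ X → hᴶ y ∈ X → x ≢ y → T (H x y)
  apex-clique {X} {x} {y} gp κ∈X x∈X y∈X x≢y with H x y in Hxy
  ... | true  = tt
  ... | false = GenPos⇒BetweenFree J gp x∈X κ∈X y∈X hᴶ≢κ (hᴶ≢κ ∘ sym) (x≢y ∘ hᴶ-injective)
    (step (hκ-edgeᴶ x) (step (κh-edgeᴶ y) stop) ,
     nonadjacent⇒2≤len J (x≢y ∘ hᴶ-injective) (subst T (trans (adjᴶ-hh x y) Hxy)) ,
     there (here refl))

  shortest-into-copy-enters-once : ∀ {w y z} → ¬ InCopy i w → (Q : Walk C w (h i z)) → Shortest Q →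
    h i y ∈ᴸ verts Q → y ≢ z → ⊥
  shortest-into-copy-enters-once {y = y} {z} w∉ Q sh y∈Q y≢z with splitAtVertex Q y∈Q
  ... | A , B , refl with splitAtVertex A (entering-copy-visits-ι i A w∉ (y , refl))
  ... | A₁ , A₂ , refl =
    a+b+c≰a+1 (len A₁) (distinct⇒1≤len ι≢h A₂) (distinct⇒1≤len (y≢z ∘ proj₂ ∘ h-injective) B)
      (subst₂ _≤_ (trans (len-++ʷ (A₁ ++ʷ A₂) B) (cong (_+ len B) (len-++ʷ A₁ A₂)))
                  (len-++ʷ A₁ (step (ιh-edge i z) stop))
        (sh (A₁ ++ʷ step (ιh-edge i z) stop)))

  shortest-out-of-copy-leaves-once : ∀ {w x y} → ¬ InCopy i w → (Q : Walk C (h i x) w) → Shortest Q →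
    h i y ∈ᴸ verts Q → x ≢ y → ⊥
  shortest-out-of-copy-leaves-once {x = x} {y} w∉ Q sh y∈Q x≢y with splitAtVertex Q y∈Q
  ... | A , B , refl with splitAtVertex B (leaving-copy-visits-ι i B (y , refl) w∉)
  ... | B₁ , B₂ , refl =
    a+b+c≰1+c (len B₂) (distinct⇒1≤len (x≢y ∘ proj₂ ∘ h-injective) A) (distinct⇒1≤len (ι≢h ∘ sym) B₁)
      (subst (_≤ suc (len B₂)) (trans (len-++ʷ A (B₁ ++ʷ B₂)) (cong (len A +_) (len-++ʷ B₁ B₂)))
        (sh (step (hι-edge i x) B₂)))

  wander-GenPos : ∀ {X w} → GenPos J X → κ ∈ X → ¬ InCopy i w → GenPos C (shift (image X) (ι i) w)
  wander-GenPos {X} {w} gp κ∈X w∉ = BetweenFree⇒GenPos C free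
    where
      classify : ∀ {p} → p ∈ shift (image X) (ι i) w → p ≡ w ⊎ Σ (Fin m) λ x → p ≡ h i x × hᴶ x ∈ X
      classify p∈ with ∈-shift⁻ {S = image X} p∈
      ... | inj₁ eq               = inj₁ eq
      ... | inj₂ (p≢ιi , p∈image) = inj₂ (∈-image-apex⁻ {X} p∈image p≢ιi)
      free : BetweenFree C (shift (image X) (ι i) w)
      free p∈ q∈ s∈ p≢q q≢s p≢s btw@(Q , sh , q∈Q) with classify p∈ | classify q∈ | classify s∈
      ... | inj₁ refl | inj₁ refl | _         = p≢q refl
      ... | inj₁ refl | _         | inj₁ refl = p≢s refl
      ... | _         | inj₁ refl | inj₁ refl = q≢s refl
      ... | inj₂ (x , refl , x∈X) | _ | inj₂ (z , refl , z∈X) =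
        [ p≢q ∘ sym , q≢s ]′
          (adjacent⇒Between-endpoint (hh-edge⁺ i (apex-clique gp κ∈X x∈X z∈X (p≢s ∘ cong (h i)))) btw)
      ... | inj₁ refl | inj₂ (y , refl , _) | inj₂ (z , refl , _) =
        shortest-into-copy-enters-once w∉ Q sh q∈Q (q≢s ∘ cong (h i))
      ... | inj₂ (x , refl , _) | inj₂ (y , refl , _) | inj₁ refl =
        shortest-out-of-copy-leaves-once w∉ Q sh q∈Q (p≢q ∘ cong (h i))

  closed-walk-avoiding-copy : ∀ {t} → ¬ InCopy i t →
    Σ (Walk C (ι i) (ι i)) λ P → t ∈ᴸ verts P × (∀ {v} → v ∈ᴸ verts P → ¬ InCopy i v)
  closed-walk-avoiding-copy {t} t∉ with view t
  ... | base j = P₁ ++ʷ P₂ , ∈-++ʷ⁺ˡ P₁ P₂ (target∈verts P₁) , avoids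
    where
      P₁ : Walk C (ι i) (ι j)
      P₁ = base-walk i j
      P₂ : Walk C (ι j) (ι i)
      P₂ = base-walk j i
      avoids : ∀ {v} → v ∈ᴸ verts (P₁ ++ʷ P₂) → ¬ InCopy i v
      avoids v∈ with ∈-++ʷ⁻ P₁ P₂ v∈
      ... | inj₁ v∈₁ = base-walk-avoids-copies v∈₁
      ... | inj₂ v∈₂ = base-walk-avoids-copies v∈₂
  ... | fibre j y = P₁ ++ʷ P₂ , ∈-++ʷ⁺ʳ P₁ P₂ (there (here refl)) , avoids
    where
      P₁ : Walk C (ι i) (ι j)
      P₁ = base-walk i j
      P₂ : Walk C (ι j) (ι i)
      P₂ = step (ιh-edge j y) (step (hι-edge j y) (base-walk j i))
      avoids : ∀ {v} → v ∈ᴸ verts (P₁ ++ʷ P₂) → ¬ InCopy i v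
      avoids v∈ with ∈-++ʷ⁻ P₁ P₂ v∈
      ... | inj₁ v∈₁                 = base-walk-avoids-copies v∈₁
      ... | inj₂ (here refl)         = ¬InCopy-ι
      ... | inj₂ (there (here refl)) = λ (_ , eq) → t∉ (y , cong (λ k → h k y) (proj₁ (h-injective eq)))
      ... | inj₂ (there (there v∈₂)) = base-walk-avoids-copies v∈₂

  apexTour : ∀ {X} → GenPos J X → Tour (image X) (λ p → ρ p ∈ X)
  apexTour {X} gp = Tour-mono cover (stay ⊕ wander)
    where
      cover : ∀ {p} → ρ p ∈ X → p ∈ image X ⊎ (κ ∈ X × ¬ InCopy i p)
      cover {p} ρp∈X with InCopy? i p
      ... | yes p∈copy = inj₁ (subst (_∈ image X) (ε∘ρ-copy p∈copy) (∈-image⁺ ρp∈X))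
      ... | no p∉copy  = inj₂ (subst (_∈ X) (ρ-outside p∉copy) ρp∈X , p∉copy)
      visit : κ ∈ X → ∀ t → Tour (image X) (λ p → p ≡ t × ¬ InCopy i t)
      visit κ∈X t with InCopy? i t
      ... | yes t∈ = Tour-mono (λ (_ , t∉) → ⊥-elim (t∉ t∈)) stay
      ... | no t∉ with closed-walk-avoiding-copy t∉
      ...   | P , t∈P , avoids = Tour-mono (λ { (refl , _) → t∈P })
                (closed-excursion ιi∈ P λ v∈ → outside∉image {X} (avoids v∈) , wander-GenPos gp κ∈X (avoids v∈))
        where
          ιi∈ : ι i ∈ image X
          ιi∈ = subst (_∈ image X) ε-κ (∈-image⁺ κ∈X)
      wander : Tour (image X) (λ p → κ ∈ X × ¬ InCopy i p)
      wander with κ ∈? X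
      ... | yes κ∈X = Tour-mono (λ {p} (_ , p∉) → p , refl , p∉) (tour-⋃ (visit κ∈X))
      ... | no κ∉X  = Tour-mono (λ (κ∈X , _) → ⊥-elim (κ∉X κ∈X)) stay

  image-Mobile-closedCopy : ∀ {S} → Mobile J S → Mobile C (image S)
  image-Mobile-closedCopy = image-Mobile apexTour

module UpperBound {n m : ℕ} (G : Graph n) (H : Graph m) (G-connected : Connected G) where
  open Corona G H
  open BaseWalks G-connected
  open WalkProperties using (BetweenFree⇒GenPos; GenPos⇒BetweenFree)
  open WalkProperties C using (shortest; source∈verts; target∈verts; _++ʷ_)
  open Robots C using (LegalMove⇒∣∣≤)

  walk-from-base : ∀ j p → Walk C (ι j) p
  walk-from-base j p with view p
  ... | base k    = base-walk j k
  ... | fibre k y = base-walk j k ++ʷ step (ιh-edge k y) stop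

  BaseWithFibre : Subset N → Set
  BaseWithFibre Y = Σ (Fin n) λ j → Σ (Fin m) λ x → ι j ∈ Y × h j x ∈ Y

  BaseWithFibre? : ∀ Y → Dec (BaseWithFibre Y)
  BaseWithFibre? Y = any? λ j → any? λ x → (ι j ∈? Y) ×-dec (h j x ∈? Y)

  BaseWithFibre⇒closedCopy : ∀ {Y j x p} → GenPos C Y → ι j ∈ Y → h j x ∈ Y → p ∈ Y → π p ≡ j
  BaseWithFibre⇒closedCopy {Y} {j} {x} {p} gp ιj∈Y hjx∈Y p∈Y with π p ≟ j
  ... | yes πp≡j = πp≡j
  ... | no πp≢j with shortest (step (hι-edge j x) (walk-from-base j p))
  ...   | Q , sh = ⊥-elim (gp (h j x) (ι j) p hjx∈Y ιj∈Y p∈Y (ι≢h ∘ sym) (πp≢j ∘ ι≡p⇒) (πp≢j ∘ hjx≡p⇒)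
    (h j x , p , Q , sh , source∈verts Q , leaving-copy-visits-ι j Q (x , refl) p∉copy , target∈verts Q))
    where
      ι≡p⇒ : ι j ≡ p → π p ≡ j
      ι≡p⇒ refl = π-ι j
      hjx≡p⇒ : h j x ≡ p → π p ≡ j
      hjx≡p⇒ refl = π-h j x
      p∉copy : ¬ InCopy j p
      p∉copy (y , refl) = πp≢j (π-h j y)

  closedCopy⇒∣∣≤gp : ∀ {Y j d} → GenPos C Y → (∀ {p} → p ∈ Y → π p ≡ j) → IsGp (join H K₁) d →
    ∣ Y ∣ ≤ d
  closedCopy⇒∣∣≤gp {Y} {j} gp in-copy (_ , maximal) =
    ≤-trans (injection⇒∣∣≤ Y Y′ ρ into inj) (maximal Y′ Y′-GenPos)
    where
      open ClosedCopy G H j using (J; ε; ρ; ε∘ρ-closedCopy; ε-injective; Between-ε)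
      Y′ : Subset (m + 1)
      Y′ = tabulate (lookup Y ∘ ε)
      ερ : ∀ {p} → p ∈ Y → ε (ρ p) ≡ p
      ερ p∈Y = ε∘ρ-closedCopy (in-copy p∈Y)
      into : ∀ {p} → p ∈ Y → ρ p ∈ Y′
      into p∈Y = ∈-tabulate⁺ (trans (cong (lookup Y) (ερ p∈Y)) ([]=⇒lookup p∈Y))
      inj : ∀ {p q} → p ∈ Y → q ∈ Y → ρ p ≡ ρ q → p ≡ q
      inj p∈Y q∈Y eq = trans (sym (ερ p∈Y)) (trans (cong ε eq) (ερ q∈Y))
      ε∈Y : ∀ {a} → a ∈ Y′ → ε a ∈ Y
      ε∈Y {a} a∈ = lookup⇒[]= (ε a) Y (∈-tabulate⁻ a∈)
      Y′-GenPos : GenPos J Y′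
      Y′-GenPos = BetweenFree⇒GenPos J λ a∈ b∈ c∈ a≢b b≢c a≢c btw →
        GenPos⇒BetweenFree C gp (ε∈Y a∈) (ε∈Y b∈) (ε∈Y c∈)
          (a≢b ∘ ε-injective) (b≢c ∘ ε-injective) (a≢c ∘ ε-injective) (Between-ε btw)

  BaseWithFibre-ahead⇒∣∣≤gp : ∀ {X cs d} → GenPos C X → Chain C X cs → Any BaseWithFibre (X ∷ cs) →
    IsGp (join H K₁) d → ∣ X ∣ ≤ d
  BaseWithFibre-ahead⇒∣∣≤gp gp _ (here (j , x , ιj∈ , hjx∈)) isGp =
    closedCopy⇒∣∣≤gp gp (BaseWithFibre⇒closedCopy gp ιj∈ hjx∈) isGp
  BaseWithFibre-ahead⇒∣∣≤gp {cs = _ ∷ _} _ (move , ch) (there a) isGp =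
    ≤-trans (LegalMove⇒∣∣≤ move) (BaseWithFibre-ahead⇒∣∣≤gp (LegalMove-GenPos move) ch a isGp)

  TwoInCopy : Fin n → Subset N → Set
  TwoInCopy j X = Σ (Fin m) λ x → Σ (Fin m) λ y → x ≢ y × h j x ∈ X × h j y ∈ X

  TwoInCopy-move : ∀ {X v a b} j → v ∉ X → T (C (h j a) v) → ¬ BaseWithFibre (shift X (h j a) v) →
    h j b ∈ X → a ≢ b → TwoInCopy j (shift X (h j a) v)
  TwoInCopy-move {X} {v} {a} {b} j v∉X e noBase b∈X a≢b with view v
  ... | base k with hι-edge⁻ e
  ...   | refl = ⊥-elim (noBase (j , b , target∈shift , b∈))
    where
      b∈ : h j b ∈ shift X (h j a) v
      b∈ = ∈-shift⁺ (a≢b ∘ sym ∘ proj₂ ∘ h-injective) b∈X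
  TwoInCopy-move {X} {v} {a} {b} j v∉X e noBase b∈X a≢b | fibre k z with hh-edge⁻ e
  ...   | refl , _ =
    z , b , (λ { refl → v∉X b∈X }) , target∈shift , ∈-shift⁺ (a≢b ∘ sym ∘ proj₂ ∘ h-injective) b∈X

  TwoInCopy-step : ∀ {X Y} j → LegalMove C X Y → ¬ BaseWithFibre Y → TwoInCopy j X → TwoInCopy j Y
  TwoInCopy-step {X} j (u , v , _ , v∉X , e , refl , _) noBase (x , y , x≢y , x∈X , y∈X)
    with u ≟ h j x | u ≟ h j y
  ... | yes refl | _        = TwoInCopy-move j v∉X e noBase y∈X x≢y
  ... | no _     | yes refl = TwoInCopy-move j v∉X e noBase x∈X (x≢y ∘ sym)
  ... | no u≢hjx | no u≢hjy = x , y , x≢y , ∈-shift⁺ (u≢hjx ∘ sym) x∈X , ∈-shift⁺ (u≢hjy ∘ sym) y∈X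

  TwoInCopy⇒base-unvisited : ∀ {X cs} j → Chain C X cs → TwoInCopy j X → ¬ Any BaseWithFibre (X ∷ cs) →
    ¬ Any (ι j ∈_) (X ∷ cs)
  TwoInCopy⇒base-unvisited j _ (x , _ , _ , hjx∈ , _) noBase (here ιj∈) = noBase (here (j , x , ιj∈ , hjx∈))
  TwoInCopy⇒base-unvisited {cs = _ ∷ _} j (move , ch) two noBase (there visited) =
    TwoInCopy⇒base-unvisited j ch (TwoInCopy-step j move (λ b → noBase (there (here b))) two)
      (λ a → noBase (there a)) visited

  π-injective-on-mobile : ∀ {S cs} → Chain C S cs → (∀ x → Any (x ∈_) (S ∷ cs)) →
    ¬ Any BaseWithFibre (S ∷ cs) →
    ∀ {p q} → p ∈ S → q ∈ S → π p ≡ π q → p ≡ q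
  π-injective-on-mobile ch covers noBase {p} {q} p∈S q∈S πp≡πq with view p | view q
  ... | base i | base k = cong ι (trans (sym (π-ι i)) (trans πp≡πq (π-ι k)))
  ... | base i | fibre k y with trans (sym (π-ι i)) (trans πp≡πq (π-h k y))
  ...   | refl = ⊥-elim (noBase (here (i , y , p∈S , q∈S)))
  π-injective-on-mobile ch covers noBase p∈S q∈S πp≡πq | fibre i x | base k
    with trans (sym (π-h i x)) (trans πp≡πq (π-ι k))
  ...   | refl = ⊥-elim (noBase (here (i , x , q∈S , p∈S)))
  π-injective-on-mobile ch covers noBase p∈S q∈S πp≡πq | fibre i x | fibre k y
    with trans (sym (π-h i x)) (trans πp≡πq (π-h k y))
  ...   | refl with x ≟ y
  ...     | yes refl = refl
  ...     | no x≢y  = ⊥-elim (TwoInCopy⇒base-unvisited i ch (x , y , x≢y , p∈S , q∈S) noBase (covers (ι i)))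

  Mobile⇒∣∣≤n⊔gp : ∀ {S d} → Mobile C S → IsGp (join H K₁) d → ∣ S ∣ ≤ n ⊔ d
  Mobile⇒∣∣≤n⊔gp {S} {d} (gp , cs , ch , covers) isGp with anyᴸ? BaseWithFibre? (S ∷ cs)
  ... | yes somewhere = ≤-trans (BaseWithFibre-ahead⇒∣∣≤gp gp ch somewhere isGp) (m≤n⊔m n d)
  ... | no nowhere    = begin
    ∣ S ∣      ≤⟨ injection⇒∣∣≤ S ⊤ π (λ _ → ∈⊤) (π-injective-on-mobile ch covers nowhere) ⟩
    ∣ ⊤ {n} ∣  ≡⟨ ∣⊤∣≡n n ⟩
    n          ≤⟨ m≤m⊔n n d ⟩
    n ⊔ d      ∎
    where open ≤-Reasoning

theorem4p1 : ∀ {n m : ℕ} (G : Graph n) (H : Graph m) →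
    1 ≤ n → Simple G → Simple H → Connected G →
    ∀ (a b c d : ℕ) →
    IsMob G a → IsMob (join H K₁) b → IsMob (corona G H) c → IsGp (join H K₁) d →
    (a ⊔ b ≤ c) × (c ≤ n ⊔ d)
theorem4p1 {suc n} G H (s≤s z≤n) (_ , G-loopless) (_ , H-loopless) G-connected a b c d
  ((SG , SG-mobile , ∣SG∣≡a) , _) ((SJ , SJ-mobile , ∣SJ∣≡b) , _) ((SC , SC-mobile , ∣SC∣≡c) , mob-maximal) gpJ =
  ⊔-lub a≤c b≤c , subst (_≤ suc n ⊔ d) ∣SC∣≡c (UpperBound.Mobile⇒∣∣≤n⊔gp G H G-connected SC-mobile gpJ)
  where
    open ≤-Reasoning
    a≤c : a ≤ c
    a≤c = begin
      a              ≡⟨ ∣SG∣≡a ⟨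
      ∣ SG ∣         ≤⟨ ∣image∣ SG ⟩
      ∣ image SG ∣   ≤⟨ mob-maximal (image SG) (image-Mobile-base SG-mobile) ⟩
      c              ∎
      where open LowerBoundFromG G H G-loopless H-loopless
    b≤c : b ≤ c
    b≤c = begin
      b              ≡⟨ ∣SJ∣≡b ⟨
      ∣ SJ ∣         ≤⟨ ∣image∣ SJ ⟩
      ∣ image SJ ∣   ≤⟨ mob-maximal (image SJ) (image-Mobile-closedCopy SJ-mobile) ⟩
      c              ∎
      where open LowerBoundFromJoin G H G-loopless H-loopless G-connected zero
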